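{- Let $G$ be a graph, $(T,\chi)$ an extreme lenient tree decomposition of $G$ of width $k$, and $G^+$ the $(T,\chi)$-completion of $G$. Then for any nodes $t,t'\in V(T)$ there exist $k$ pairwise vertex-disjoint $\chi(t)$–$\chi(t')$ paths in $G^+$.
   Context: Lenient tree decomposition: $(T,\chi)$, $T$ a tree, $\chi:V(T)\to 2^{V(G)}$, with (C1) bags covering $V(G)$; (C2) every edge $e$ of $G$ satisfies $e\subseteq\chi(t)\cup\chi(t')$ for some close nodes $t,t'$ (equal or adjacent); (C3) $\{t:x\in\chi(t)\}$ is connected in $T$ for every $x$. Width: $\max_t|\chi(t)|$. For a leaf $t$ with neighbour $t'$, ${\sf Petal}(t)=\chi(t)\setminus\chi(t')$. It is extreme (of width $k$) if: all bags have equal size; no bag is a subset of another; for every degree-2 node $t$ and nodes $t',t''$ with $t$ on the $t'$–$t''$ path, $\chi(t)\not\subseteq\chi(t')\cup\chi(t'')$; for distinct leaf neighbours $t',t''$ of any node, $|{\sf Petal}(t')\cup{\sf Petal}(t'')|>k$. The $(T,\chi)$-completion $G^+$ has vertex set $V(G)$ and edge set $\bigcup\binom{\chi(t)\cup\chi(t')}{2}$ over close pairs $t,t'$. An $X$–$Y$ path is a path with one end in $X$ and the other in $Y$ (a single vertex is allowed). -}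

module Defs where

open import Data.Nat using (ℕ; _<_; _≤_)
open import Data.Fin using (Fin)
open import Data.Fin.Subset using (Subset; _∈_; _∉_; _⊆_; _∪_; _─_; ∣_∣)
open import Data.List using (List; _∷_)
open import Data.List.NonEmpty using (List⁺; toList; head; last)
open import Data.List.Relation.Unary.Linked using (Linked)
open import Data.List.Relation.Unary.All using (All)
open import Data.List.Relation.Unary.Unique.Propositional using (Unique)
open import Data.List.Membership.Propositional using () renaming (_∈_ to _∈ₗ_)
open import Data.Product using (Σ; ∃; ∃-syntax; _×_)
open import Data.Sum using (_⊎_)
open import Relation.Binary.PropositionalEquality using (_≡_; _≢_)
open import Relation.Nullary using (¬_)

record Graph (n : ℕ) : Set₁ where
  field
    Adj   : Fin n → Fin n → Set
    sym   : ∀ {x y} → Adj x y → Adj y x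
    irrefl : ∀ {x} → ¬ Adj x x
open Graph public

record Path {n : ℕ} (R : Fin n → Fin n → Set) : Set where
  field
    verts    : List⁺ (Fin n)
    linked   : Linked R (toList verts)
    distinct : Unique (toList verts)
open Path public

start end : ∀ {n} {R : Fin n → Fin n → Set} → Path R → Fin n
start P = head (verts P)
end   P = last (verts P)

_onPath_ : ∀ {n} {R : Fin n → Fin n → Set} → Fin n → Path R → Set
v onPath P = v ∈ₗ toList (verts P)

record Tree (m : ℕ) : Set₁ where
  field
    graph    : Graph m
    path     : ∀ u v → Σ (Path (Adj graph)) λ P → start P ≡ u × end P ≡ v
    pathUniq : ∀ (P Q : Path (Adj graph)) → start P ≡ start Q → end P ≡ end Q
               → verts P ≡ verts Q
open Tree public

module _ {m : ℕ} (T : Tree m) where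
  TAdj : Fin m → Fin m → Set
  TAdj = Adj (graph T)

  Close : Fin m → Fin m → Set
  Close t t' = t ≡ t' ⊎ TAdj t t'

  Leaf : Fin m → Set
  Leaf t = ∃[ a ] (TAdj t a × ∀ c → TAdj t c → c ≡ a)

  Degree2 : Fin m → Set
  Degree2 t = ∃[ a ] ∃[ b ] (a ≢ b × TAdj t a × TAdj t b
                × ∀ c → TAdj t c → c ≡ a ⊎ c ≡ b)

record IsLenientTD {n m : ℕ} (G : Graph n) (T : Tree m) (χ : Fin m → Subset n) : Set where
  field
    C1 : ∀ x → ∃[ t ] (x ∈ χ t)
    C2 : ∀ x y → Adj G x y →
         ∃[ t ] ∃[ t' ] (Close T t t' × x ∈ (χ t ∪ χ t') × y ∈ (χ t ∪ χ t'))
    C3 : ∀ x t t' → x ∈ χ t → x ∈ χ t' →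
         Σ (Path (TAdj T)) λ P → start P ≡ t × end P ≡ t'
           × All (λ s → x ∈ χ s) (toList (verts P))

HasWidth : ∀ {n m} → (Fin m → Subset n) → ℕ → Set
HasWidth χ k = (∀ t → ∣ χ t ∣ ≤ k) × ∃[ t ] (∣ χ t ∣ ≡ k)

record IsExtreme {n m : ℕ} (T : Tree m) (χ : Fin m → Subset n) (k : ℕ) : Set where
  field
    equalSize  : ∀ t t' → ∣ χ t ∣ ≡ ∣ χ t' ∣
    noSubset   : ∀ t t' → t ≢ t' → ¬ (χ t ⊆ χ t')
    degree2    : ∀ t → Degree2 T t → ∀ (P : Path (TAdj T)) →
                 t onPath P → t ≢ start P → t ≢ end P →
                 ¬ (χ t ⊆ (χ (start P) ∪ χ (end P)))
    petals     : ∀ s l₁ l₂ → l₁ ≢ l₂ → Leaf T l₁ → Leaf T l₂ →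
                 TAdj T s l₁ → TAdj T s l₂ →
                 k < ∣ (χ l₁ ─ χ s) ∪ (χ l₂ ─ χ s) ∣

CompAdj : ∀ {n m} → Tree m → (Fin m → Subset n) → Fin n → Fin n → Set
CompAdj T χ x y = x ≢ y × ∃[ t ] ∃[ t' ] (Close T t t'
                    × x ∈ (χ t ∪ χ t') × y ∈ (χ t ∪ χ t'))

IsXYPath : ∀ {n} {R : Fin n → Fin n → Set} → Subset n → Subset n → Path R → Set
IsXYPath X Y P = start P ∈ X × end P ∈ Y

VertexDisjoint : ∀ {n} {R : Fin n → Fin n → Set} → Path R → Path R → Set
VertexDisjoint P Q = ∀ v → v onPath P → ¬ (v onPath Q)

-- Walk along the tree path t = s₀, s₁, …, s_r = t' from its far end. Suppose k disjoint
-- χ(s₁)–χ(t') paths are given, each using only vertices of bags s₁, …, s_r. Since all bags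
-- have the same size, |χ(s₁) ∖ χ(s₀)| = |χ(s₀) ∖ χ(s₁)|, so the paths starting outside χ(s₀)
-- can be extended by distinct vertices of χ(s₀) ∖ χ(s₁); each such vertex is adjacent in G⁺
-- to everything in χ(s₁), and by (C3) it lies in no bag beyond s₁, hence on none of the paths.
module Submission where

open import Defs hiding (sym)
open import Data.Nat using (ℕ; suc; _+_; _≤_)
open import Data.Nat.Properties using (≤-reflexive; +-suc; +-cancelʳ-≤)
open import Data.Fin using (Fin; zero; suc; inject≤)
open import Data.Fin.Properties using (suc-injective; inject≤-injective)
open import Data.Fin.Subset using (Subset; _∈_; _∉_; _∩_; _─_; ∣_∣; inside; outside)
open import Data.Fin.Subset.Properties
  using (_∈?_; x∈p∪q⁺; x∈p∧x∉q⇒x∈p─q; p─q⊆p; ∩-comm)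
open import Data.Vec using ([]; _∷_; here; there)
open import Data.List using (List; []; _∷_; initLast; _∷ʳ′_)
open import Data.List.NonEmpty using (List⁺; head; tail; last; toList) renaming (_∷_ to _∷⁺_)
open import Data.List.Relation.Unary.Linked using (Linked; [-]; _∷_)
open import Data.List.Relation.Unary.All using (All; [])
import Data.List.Relation.Unary.All as All
open import Data.List.Relation.Unary.Any using (Any; here; there)
open import Data.List.Relation.Unary.AllPairs using ([]; _∷_)
open import Data.List.Relation.Unary.Unique.Propositional using (Unique)
open import Data.List.Membership.Propositional using (find) renaming (_∈_ to _∈ₗ_)
open import Data.Product using (Σ; _×_; _,_)
open import Data.Sum using (_⊎_; inj₁; inj₂; [_,_])
open import Function using (_∘_)
open import Relation.Binary.PropositionalEquality
  using (_≡_; _≢_; refl; sym; trans; cong; subst)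
open import Relation.Nullary using (¬_; Dec; yes; no)

private
  variable
    n : ℕ
    x y : Fin n
    p q : Subset n

nth : (p : Subset n) → Fin ∣ p ∣ → Fin n
nth (inside  ∷ p) zero    = zero
nth (inside  ∷ p) (suc i) = suc (nth p i)
nth (outside ∷ p) i       = suc (nth p i)

nth-∈ : ∀ (p : Subset n) i → nth p i ∈ p
nth-∈ (inside  ∷ p) zero    = here
nth-∈ (inside  ∷ p) (suc i) = there (nth-∈ p i)
nth-∈ (outside ∷ p) i       = there (nth-∈ p i)

nth-injective : ∀ (p : Subset n) {i j} → nth p i ≡ nth p j → i ≡ j
nth-injective (inside  ∷ p) {zero}  {zero}  _  = refl
nth-injective (inside  ∷ p) {suc i} {suc j} eq = cong suc (nth-injective p (suc-injective eq))
nth-injective (outside ∷ p)                 eq = nth-injective p (suc-injective eq)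

index : x ∈ p → Fin ∣ p ∣
index {p = inside  ∷ p} here      = zero
index {p = inside  ∷ p} (there q) = suc (index q)
index {p = outside ∷ p} (there q) = index q

nth-index : (x∈p : x ∈ p) → nth p (index x∈p) ≡ x
nth-index {p = inside  ∷ p} here      = refl
nth-index {p = inside  ∷ p} (there q) = cong suc (nth-index q)
nth-index {p = outside ∷ p} (there q) = cong suc (nth-index q)

record _↪_ {n} (p q : Subset n) : Set where
  field
    map           : x ∈ p → Fin n
    map-∈         : (x∈p : x ∈ p) → map x∈p ∈ q
    map-injective : (x∈p : x ∈ p) (y∈p : y ∈ p) → map x∈p ≡ map y∈p → x ≡ y

∣p∣≤∣q∣⇒p↪q : ∣ p ∣ ≤ ∣ q ∣ → p ↪ q
∣p∣≤∣q∣⇒p↪q {p = p} {q = q} ∣p∣≤∣q∣ = record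
  { map           = map
  ; map-∈         = nth-∈ q ∘ position
  ; map-injective = λ x∈p y∈p eq →
      trans (sym (nth-index x∈p))
        (trans (cong (nth p) (inject≤-injective _ _ _ _ (nth-injective q eq))) (nth-index y∈p))
  }
  where
  position : x ∈ p → Fin ∣ q ∣
  position x∈p = inject≤ (index x∈p) ∣p∣≤∣q∣
  map : x ∈ p → Fin _
  map = nth q ∘ position

x∈p─q⇒x∉q : x ∈ p ─ q → x ∉ q
x∈p─q⇒x∉q {p = _ ∷ p} {q = inside  ∷ q} (there x∈p─q) (there x∈q) = x∈p─q⇒x∉q x∈p─q x∈q
x∈p─q⇒x∉q {p = _ ∷ p} {q = outside ∷ q} (there x∈p─q) (there x∈q) = x∈p─q⇒x∉q x∈p─q x∈q

∣p─q∣+∣p∩q∣≡∣p∣ : ∀ (p q : Subset n) → ∣ p ─ q ∣ + ∣ p ∩ q ∣ ≡ ∣ p ∣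
∣p─q∣+∣p∩q∣≡∣p∣ []            []            = refl
∣p─q∣+∣p∩q∣≡∣p∣ (outside ∷ p) (outside ∷ q) = ∣p─q∣+∣p∩q∣≡∣p∣ p q
∣p─q∣+∣p∩q∣≡∣p∣ (outside ∷ p) (inside  ∷ q) = ∣p─q∣+∣p∩q∣≡∣p∣ p q
∣p─q∣+∣p∩q∣≡∣p∣ (inside  ∷ p) (outside ∷ q) = cong suc (∣p─q∣+∣p∩q∣≡∣p∣ p q)
∣p─q∣+∣p∩q∣≡∣p∣ (inside  ∷ p) (inside  ∷ q) =
  trans (+-suc _ _) (cong suc (∣p─q∣+∣p∩q∣≡∣p∣ p q))

∣p∣≤∣q∣⇒∣p─q∣≤∣q─p∣ : ∀ (p q : Subset n) → ∣ p ∣ ≤ ∣ q ∣ → ∣ p ─ q ∣ ≤ ∣ q ─ p ∣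
∣p∣≤∣q∣⇒∣p─q∣≤∣q─p∣ p q ∣p∣≤∣q∣ = +-cancelʳ-≤ ∣ p ∩ q ∣ _ _ (begin
  ∣ p ─ q ∣ + ∣ p ∩ q ∣  ≡⟨ ∣p─q∣+∣p∩q∣≡∣p∣ p q ⟩
  ∣ p ∣                  ≤⟨ ∣p∣≤∣q∣ ⟩
  ∣ q ∣                  ≡⟨ sym (∣p─q∣+∣p∩q∣≡∣p∣ q p) ⟩
  ∣ q ─ p ∣ + ∣ q ∩ p ∣  ≡⟨ cong (λ r → ∣ q ─ p ∣ + ∣ r ∣) (∩-comm q p) ⟩
  ∣ q ─ p ∣ + ∣ p ∩ q ∣  ∎)
  where open Data.Nat.Properties.≤-Reasoning

last-∷ : ∀ {A : Set} (x y : A) ys → last (x ∷⁺ y ∷ ys) ≡ last (y ∷⁺ ys)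
last-∷ x y ys with initLast ys
... | []       = refl
... | _ ∷ʳ′ _ = refl

module _ {A : Set} where

  prefix : ∀ {a} (xs : List⁺ A) → a ∈ₗ toList xs → List⁺ A
  prefix (x ∷⁺ _)      (here _)  = x ∷⁺ []
  prefix (x ∷⁺ y ∷ ys) (there p) = x ∷⁺ toList (prefix (y ∷⁺ ys) p)

  head-prefix : ∀ {a} xs (p : a ∈ₗ toList xs) → head (prefix xs p) ≡ head xs
  head-prefix (x ∷⁺ _)      (here _)  = refl
  head-prefix (x ∷⁺ y ∷ ys) (there p) = refl

  last-prefix : ∀ {a} xs (p : a ∈ₗ toList xs) → last (prefix xs p) ≡ a
  last-prefix (x ∷⁺ _)      (here a≡x) = sym a≡x
  last-prefix (x ∷⁺ y ∷ ys) (there p)  with prefix (y ∷⁺ ys) p | last-prefix (y ∷⁺ ys) p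
  ... | z ∷⁺ zs | last≡a = trans (last-∷ x z zs) last≡a

  prefix-⊆ : ∀ {a b} xs (p : a ∈ₗ toList xs) → b ∈ₗ toList (prefix xs p) → b ∈ₗ toList xs
  prefix-⊆ (x ∷⁺ _)      (here _)  (here b≡x) = here b≡x
  prefix-⊆ (x ∷⁺ y ∷ ys) (there p) (here b≡x) = here b≡x
  prefix-⊆ (x ∷⁺ y ∷ ys) (there p) (there q)  = there (prefix-⊆ (y ∷⁺ ys) p q)

  prefix-linked : ∀ {R : A → A → Set} {a} xs (p : a ∈ₗ toList xs) →
                  Linked R (toList xs) → Linked R (toList (prefix xs p))
  prefix-linked (x ∷⁺ _)      (here _)  _           = [-]
  prefix-linked (x ∷⁺ y ∷ ys) (there p) (Rxy ∷ rest)
    with prefix (y ∷⁺ ys) p | head-prefix (y ∷⁺ ys) p | prefix-linked (y ∷⁺ ys) p rest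
  ... | .y ∷⁺ _ | refl | linked = Rxy ∷ linked

  prefix-unique : ∀ {a} xs (p : a ∈ₗ toList xs) → Unique (toList xs) → Unique (toList (prefix xs p))
  prefix-unique (x ∷⁺ _)      (here _)  _                 = [] ∷ []
  prefix-unique (x ∷⁺ y ∷ ys) (there p) (x∉ys ∷ unique) =
    All.tabulate (All.lookup x∉ys ∘ prefix-⊆ (y ∷⁺ ys) p) ∷ prefix-unique (y ∷⁺ ys) p unique

module _ {n} {R : Fin n → Fin n → Set} where

  singleton : Fin n → Path R
  singleton v = record { verts = v ∷⁺ [] ; linked = [-] ; distinct = [] ∷ [] }

  cons : (v : Fin n) (P : Path R) → R v (start P) → ¬ v onPath P → Path R
  cons v P Rv v∉P = record
    { verts    = v ∷⁺ toList (verts P)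
    ; linked   = Rv ∷ linked P
    ; distinct = All.tabulate (λ { w∈P refl → v∉P w∈P }) ∷ distinct P
    }

  end-cons : ∀ v P Rv v∉P → end (cons v P Rv v∉P) ≡ end P
  end-cons v P _ _ = last-∷ v (head (verts P)) (tail (verts P))

record Linkage {n} (R : Fin n → Fin n → Set) (k : ℕ) (X Y : Subset n) (U : Fin n → Set) : Set where
  field
    paths    : Fin k → Path R
    start∈X  : ∀ i → start (paths i) ∈ X
    end∈Y    : ∀ i → end (paths i) ∈ Y
    disjoint : ∀ i j → i ≢ j → VertexDisjoint (paths i) (paths j)
    within   : ∀ i {v} → v onPath paths i → U v

module _ {n} {R : Fin n → Fin n → Set} {k : ℕ} {X Y : Subset n} where

  weaken : ∀ {U V : Fin n → Set} → (∀ {v} → U v → V v) → Linkage R k X Y U → Linkage R k X Y V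
  weaken U⇒V L = record { Linkage L ; within = λ i → U⇒V ∘ Linkage.within L i }

trivialLinkage : ∀ {n} {R : Fin n → Fin n → Set} {k} {X : Subset n} →
                 k ≤ ∣ X ∣ → Linkage R k X X (_∈ X)
trivialLinkage {n} {k = k} {X} k≤∣X∣ = record
  { paths    = singleton ∘ vertex
  ; start∈X  = nth-∈ X ∘ position
  ; end∈Y    = nth-∈ X ∘ position
  ; disjoint = λ { i j i≢j _ (here v≡i) (here v≡j) →
      i≢j (inject≤-injective _ _ _ _ (nth-injective X (trans (sym v≡i) v≡j))) }
  ; within   = λ { i (here refl) → nth-∈ X (position i) }
  }
  where
  position : Fin k → Fin ∣ X ∣
  position i = inject≤ i k≤∣X∣
  vertex : Fin k → Fin n
  vertex = nth X ∘ position

module Extension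
  {n} {R : Fin n → Fin n → Set} {k} {A B Y : Subset n} {U : Fin n → Set}
  (∣B∣≤∣A∣   : ∣ B ∣ ≤ ∣ A ∣)
  (complete  : ∀ {a b} → a ∈ A → b ∈ B → a ≢ b → R a b)
  (separates : ∀ {v} → v ∈ A → U v → v ∈ B)
  (L : Linkage R k B Y U)
  where

  open Linkage L
  open _↪_ (∣p∣≤∣q∣⇒p↪q {p = B ─ A} {q = A ─ B} (∣p∣≤∣q∣⇒∣p─q∣≤∣q─p∣ B A ∣B∣≤∣A∣))

  module _ (i : Fin k) (∉A : start (paths i) ∉ A) where

    start∈B─A : start (paths i) ∈ B ─ A
    start∈B─A = x∈p∧x∉q⇒x∈p─q (start∈X i) ∉A

    partner : Fin n
    partner = map start∈B─A

    partner∈A : partner ∈ A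
    partner∈A = p─q⊆p A B (map-∈ start∈B─A)

    partner∉B : partner ∉ B
    partner∉B = x∈p─q⇒x∉q (map-∈ start∈B─A)

    partner-adjacent : R partner (start (paths i))
    partner-adjacent =
      complete partner∈A (start∈X i) λ eq → partner∉B (subst (_∈ B) (sym eq) (start∈X i))

    partner-avoids : ∀ j → ¬ partner onPath paths j
    partner-avoids j on = partner∉B (separates partner∈A (within j on))

  partner-injective : ∀ i j ∉A ∉A′ → partner i ∉A ≡ partner j ∉A′ → start (paths i) ≡ start (paths j)
  partner-injective i j ∉A ∉A′ = map-injective (start∈B─A i ∉A) (start∈B─A j ∉A′)

  extend : ∀ i → Dec (start (paths i) ∈ A) → Path R
  extend i (yes _)  = paths i
  extend i (no ∉A) = cons (partner i ∉A) (paths i) (partner-adjacent i ∉A) (partner-avoids i ∉A i)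

  start-extend : ∀ i d → start (extend i d) ∈ A
  start-extend i (yes ∈A) = ∈A
  start-extend i (no ∉A) = partner∈A i ∉A

  end-extend : ∀ i d → end (extend i d) ∈ Y
  end-extend i (yes _)  = end∈Y i
  end-extend i (no ∉A) =
    subst (_∈ Y) (sym (end-cons _ (paths i) (partner-adjacent i ∉A) (partner-avoids i ∉A i))) (end∈Y i)

  onPath-extend : ∀ i d {v} → v onPath extend i d →
                  v onPath paths i ⊎ Σ (start (paths i) ∉ A) λ ∉A → v ≡ partner i ∉A
  onPath-extend i (yes _)  on          = inj₁ on
  onPath-extend i (no ∉A) (here v≡)   = inj₂ (∉A , v≡)
  onPath-extend i (no ∉A) (there on)  = inj₁ on

  decide : ∀ i → Dec (start (paths i) ∈ A)
  decide i = start (paths i) ∈? A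

  extended : Fin k → Path R
  extended i = extend i (decide i)

  extended-disjoint : ∀ i j → i ≢ j → VertexDisjoint (extended i) (extended j)
  extended-disjoint i j i≢j v onᵢ onⱼ
    with onPath-extend i (decide i) onᵢ | onPath-extend j (decide j) onⱼ
  ... | inj₁ onᵢ′        | inj₁ onⱼ′         = disjoint i j i≢j v onᵢ′ onⱼ′
  ... | inj₂ (∉A , refl) | inj₁ onⱼ′         = partner-avoids i ∉A j onⱼ′
  ... | inj₁ onᵢ′        | inj₂ (∉A′ , refl) = partner-avoids j ∉A′ i onᵢ′
  ... | inj₂ (∉A , refl) | inj₂ (∉A′ , eq)   =
    disjoint i j i≢j _ (here refl) (here (partner-injective i j ∉A ∉A′ eq))

  extendLinkage : Linkage R k A Y (λ v → U v ⊎ v ∈ A)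
  extendLinkage = record
    { paths    = extended
    ; start∈X  = λ i → start-extend i (decide i)
    ; end∈Y    = λ i → end-extend i (decide i)
    ; disjoint = extended-disjoint
    ; within   = λ i on → Data.Sum.map (within i) (λ { (∉A , refl) → partner∈A i ∉A })
                                         (onPath-extend i (decide i) on)
    }

open Extension using (extendLinkage)

module _ {n m} {G : Graph n} {T : Tree m} {χ : Fin m → Subset n} (td : IsLenientTD G T χ) where

  ∈-bags-along-path : ∀ (P : Path (TAdj T)) → x ∈ χ (start P) → x ∈ χ (end P) →
                      All (λ s → x ∈ χ s) (toList (verts P))
  ∈-bags-along-path {x = x} P x∈start x∈end
    with IsLenientTD.C3 td x (start P) (end P) x∈start x∈end
  ... | Q , start≡ , end≡ , x∈Q =
    subst (λ vs → All (λ s → x ∈ χ s) (toList vs)) (pathUniq T Q P start≡ end≡) x∈Q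

  InBags : List (Fin m) → Fin n → Set
  InBags ss v = Any (λ s → v ∈ χ s) ss

  ∈-next-bag : ∀ s₀ s₁ ss → Linked (TAdj T) (s₀ ∷ s₁ ∷ ss) → Unique (s₀ ∷ s₁ ∷ ss) →
               x ∈ χ s₀ → InBags (s₁ ∷ ss) x → x ∈ χ s₁
  ∈-next-bag {x = x} s₀ s₁ ss linked unique x∈s₀ x∈later
    with find x∈later
  ... | s , s∈ss , x∈s =
    subst (λ s′ → x ∈ χ s′) (head-prefix (s₁ ∷⁺ ss) s∈ss)
      (All.head (All.tail (∈-bags-along-path toS x∈s₀ (subst (λ s′ → x ∈ χ s′) (sym end≡s) x∈s))))
    where
    toS : Path (TAdj T)
    toS = record
      { verts    = prefix (s₀ ∷⁺ s₁ ∷ ss) (there s∈ss)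
      ; linked   = prefix-linked (s₀ ∷⁺ s₁ ∷ ss) (there s∈ss) linked
      ; distinct = prefix-unique (s₀ ∷⁺ s₁ ∷ ss) (there s∈ss) unique
      }
    end≡s : end toS ≡ s
    end≡s = last-prefix (s₀ ∷⁺ s₁ ∷ ss) (there s∈ss)

  bags-complete : ∀ {s s′} → Close T s s′ → x ∈ χ s → y ∈ χ s′ → x ≢ y → CompAdj T χ x y
  bags-complete {s = s} {s′} close x∈s y∈s′ x≢y =
    x≢y , s , s′ , close , x∈p∪q⁺ (inj₁ x∈s) , x∈p∪q⁺ (inj₂ y∈s′)

  pathLinkage : ∀ {k} → (∀ s → ∣ χ s ∣ ≡ k) →
                ∀ s₀ ss → Linked (TAdj T) (s₀ ∷ ss) → Unique (s₀ ∷ ss) →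
                Linkage (CompAdj T χ) k (χ s₀) (χ (last (s₀ ∷⁺ ss))) (InBags (s₀ ∷ ss))
  pathLinkage ∣χ∣≡k s₀ [] _ _ = weaken here (trivialLinkage (≤-reflexive (sym (∣χ∣≡k s₀))))
  pathLinkage ∣χ∣≡k s₀ (s₁ ∷ ss) linked@(s₀~s₁ ∷ linked′) unique@(_ ∷ unique′) =
    subst (λ t → Linkage (CompAdj T χ) _ (χ s₀) (χ t) (InBags (s₀ ∷ s₁ ∷ ss)))
      (sym (last-∷ s₀ s₁ ss))
      (weaken [ there , here ]
        (extendLinkage (≤-reflexive (trans (∣χ∣≡k s₁) (sym (∣χ∣≡k s₀))))
          (bags-complete (inj₂ s₀~s₁))
          (∈-next-bag s₀ s₁ ss linked unique)
          (pathLinkage ∣χ∣≡k s₁ ss linked′ unique′)))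

mainTheorem17 : ∀ {n m : ℕ} (G : Graph n) (T : Tree m) (χ : Fin m → Subset n) (k : ℕ)
    → IsLenientTD G T χ → HasWidth χ k → IsExtreme T χ k
    → ∀ (t t' : Fin m)
    → Σ (Fin k → Path (CompAdj T χ)) λ 𝒫
        → (∀ i → IsXYPath (χ t) (χ t') (𝒫 i))
        × (∀ i j → i ≢ j → VertexDisjoint (𝒫 i) (𝒫 j))
mainTheorem17 G T χ k td (_ , s , ∣χs∣≡k) extreme t t' with path T t t'
... | P , refl , refl = paths , (λ i → start∈X i , end∈Y i) , disjoint
  where
  ∣χ∣≡k : ∀ s′ → ∣ χ s′ ∣ ≡ k
  ∣χ∣≡k s′ = trans (IsExtreme.equalSize extreme s′ s) ∣χs∣≡k
  open Linkage (pathLinkage td ∣χ∣≡k (head (verts P)) (tail (verts P))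
                            (linked P) (distinct P))
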